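{- Let $\mathcal{N}$ be a finite, directed acyclic network of recurrent components and presinks. Then $\mathcal{N}$ cannot emulate a delayer.
   Context: Components are finite abelian processors (finite state space, commuting transition maps $t_i$, output maps $o_i$ with $o_i+o_jt_i=o_j+o_it_j$); recurrent means every state can be reached from every other state by some input. An abelian network is a directed graph with such a processor at each node, outputs feeding inputs, with designated input and output wires; it emulates a processor if it computes the same function. A presink has states $0,1$: in state $0$ an input letter moves it permanently to state $1$ and one letter is emitted; later inputs are ignored, so from state $0$ it computes $x\mapsto\min(x,1)$. A delayer has states $0,1$: in state $0$ an input letter moves it permanently to state $1$ and nothing is emitted; in state $1$ it emits one letter per letter received, so from state $0$ it computes $x\mapsto\max(x-1,0)$. -}

module Defs where

open import Data.Nat using (ℕ; zero; suc; _+_; _∸_)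
open import Data.Fin using (Fin; zero; suc; _≟_)
open import Data.List using (List; []; _∷_; concatMap; replicate; foldr; allFin)
open import Data.Bool using (if_then_else_)
open import Data.Product using (Σ; ∃; _×_; _,_)
open import Relation.Nullary using (¬_; yes; no)
open import Relation.Nullary.Decidable using (⌊_⌋)
open import Relation.Binary.PropositionalEquality using (_≡_; refl)
open import Relation.Binary.Construct.Closure.Transitive using (TransClosure)
open import Relation.Binary.Construct.Closure.ReflexiveTransitive using (Star)

-- Transition t a, output o a
-- (o a q b = number of letters b emitted when letter a is read in state q).

record Processor (k l : ℕ) : Set where
  field
    nQ    : ℕ
    t     : Fin k → Fin nQ → Fin nQ
    o     : Fin k → Fin nQ → Fin l → ℕ
    comm  : ∀ i j q → t i (t j q) ≡ t j (t i q)
    outAb : ∀ i j q b → o i q b + o j (t i q) b ≡ o j q b + o i (t j q) b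

open Processor public

runState : ∀ {k l} (P : Processor k l) → List (Fin k) → Fin (nQ P) → Fin (nQ P)
runState P []      q = q
runState P (a ∷ w) q = runState P w (t P a q)

runOut : ∀ {k l} (P : Processor k l) → List (Fin k) → Fin (nQ P) → Fin l → ℕ
runOut P []      q b = 0
runOut P (a ∷ w) q b = o P a q b + runOut P w (t P a q) b

-- a canonical word with letter count vector x (by the abelian property the
-- result does not depend on the order)
wordOf : ∀ {k} → (Fin k → ℕ) → List (Fin k)
wordOf {k} x = concatMap (λ i → replicate (x i) i) (allFin k)

compute : ∀ {k l} (P : Processor k l) → Fin (nQ P) → (Fin k → ℕ) → Fin l → ℕ
compute P q x = runOut P (wordOf x) q

Recurrent : ∀ {k l} → Processor k l → Set
Recurrent {k} P = ∀ q q′ → ∃ λ (w : List (Fin k)) → runState P w q ≡ q′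

presink : Processor 1 1
presink = record
  { nQ = 2
  ; t = λ _ _ → suc zero
  ; o = po
  ; comm = λ _ _ _ → refl
  ; outAb = λ { zero zero q b → refl }
  }
  where
  po : Fin 1 → Fin 2 → Fin 1 → ℕ
  po _ zero _ = 1
  po _ (suc zero) _ = 0

delayer : Processor 1 1
delayer = record
  { nQ = 2
  ; t = λ _ _ → suc zero
  ; o = dout
  ; comm = λ _ _ _ → refl
  ; outAb = λ { zero zero q b → refl }
  }
  where
  dout : Fin 1 → Fin 2 → Fin 1 → ℕ
  dout _ zero _ = 0
  dout _ (suc zero) _ = 1

data Component : ℕ → ℕ → Set where
  recurrentC : ∀ {k l} (P : Processor k l) → Recurrent P → Component k l
  presinkC   : Component 1 1

procOf : ∀ {k l} → Component k l → Processor k l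
procOf (recurrentC P _) = P
procOf presinkC         = presink

-- Networks: N nodes, m network input wires, p network output wires.
-- Every wire (network input wire or node output wire) leads to a
-- destination: a network output wire or an input wire of a node.
-- Several wires may lead into the same destination.

data Dest (N p : ℕ) (ins : Fin N → ℕ) : Set where
  toOut  : Fin p → Dest N p ins
  toNode : (w : Fin N) → Fin (ins w) → Dest N p ins

record Network (m p : ℕ) : Set where
  field
    N      : ℕ
    ins    : Fin N → ℕ
    outs   : Fin N → ℕ
    comp   : (v : Fin N) → Component (ins v) (outs v)
    inWire : Fin m → Dest N p ins
    wire   : (v : Fin N) → Fin (outs v) → Dest N p ins

  proc : (v : Fin N) → Processor (ins v) (outs v)
  proc v = procOf (comp v)

open Network public

data Edge {m p} (net : Network m p) (v w : Fin (N net)) : Set where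
  edge : (b : Fin (outs net v)) (c : Fin (ins net w)) →
         wire net v b ≡ toNode w c → Edge net v w

Acyclic : ∀ {m p} → Network m p → Set
Acyclic net = ∀ v → ¬ TransClosure (Edge net) v v

record Config {m p} (net : Network m p) : Set where
  field
    state    : (v : Fin (N net)) → Fin (nQ (proc net v))
    pend     : (v : Fin (N net)) → Fin (ins net v) → ℕ   -- letters waiting at node inputs
    extPend  : Fin m → ℕ                                  -- letters waiting at network inputs
    outCount : Fin p → ℕ                                  -- letters emitted on network outputs

open Config public

module _ {m p : ℕ} {net : Network m p} where

  private
    NN = N net

  addAt : ((v : Fin NN) → Fin (ins net v) → ℕ) → (w : Fin NN) → Fin (ins net w) → ℕ →
          (v : Fin NN) → Fin (ins net v) → ℕ
  addAt f w c n v a with w ≟ v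
  ... | yes refl = if ⌊ c ≟ a ⌋ then f v a + n else f v a
  ... | no _     = f v a

  decAt : ((v : Fin NN) → Fin (ins net v) → ℕ) → (w : Fin NN) → Fin (ins net w) →
          (v : Fin NN) → Fin (ins net v) → ℕ
  decAt f w c v a with w ≟ v
  ... | yes refl = if ⌊ c ≟ a ⌋ then f v a ∸ 1 else f v a
  ... | no _     = f v a

  addOut : (Fin p → ℕ) → Fin p → ℕ → Fin p → ℕ
  addOut f j n i = if ⌊ j ≟ i ⌋ then f i + n else f i

  decExt : (Fin m → ℕ) → Fin m → Fin m → ℕ
  decExt f j i = if ⌊ j ≟ i ⌋ then f i ∸ 1 else f i

  setState : ((v : Fin NN) → Fin (nQ (proc net v))) → (w : Fin NN) → Fin (nQ (proc net w)) →
             (v : Fin NN) → Fin (nQ (proc net v))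
  setState s w q v with w ≟ v
  ... | yes refl = q
  ... | no _     = s v

  deliver : Dest NN p (ins net) → ℕ → Config net → Config net
  deliver (toOut j) n cfg = record cfg { outCount = addOut (outCount cfg) j n }
  deliver (toNode w c) n cfg = record cfg { pend = addAt (pend cfg) w c n }

  emit : (v : Fin NN) → Fin (ins net v) → Fin (nQ (proc net v)) → Config net → Config net
  emit v a q cfg = foldr (λ b c′ → deliver (wire net v b) (o (proc net v) a q b) c′) cfg (allFin (outs net v))

  data Step : Config net → Config net → Set where
    extStep  : ∀ cfg (i : Fin m) {n} → extPend cfg i ≡ suc n →
               Step cfg (deliver (inWire net i) 1 (record cfg { extPend = decExt (extPend cfg) i }))
    nodeStep : ∀ cfg (v : Fin NN) (a : Fin (ins net v)) {n} → pend cfg v a ≡ suc n →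
               Step cfg (emit v a (state cfg v)
                          (record cfg { pend  = decAt (pend cfg) v a
                                      ; state = setState (state cfg) v (t (proc net v) a (state cfg v)) }))

  Halted : Config net → Set
  Halted cfg = (∀ i → extPend cfg i ≡ 0) × (∀ v a → pend cfg v a ≡ 0)

  initial : ((v : Fin NN) → Fin (nQ (proc net v))) → (Fin m → ℕ) → Config net
  initial s x = record { state = s ; pend = λ _ _ → 0 ; extPend = x ; outCount = λ _ → 0 }

Computes : ∀ {m p} (net : Network m p) → ((v : Fin (N net)) → Fin (nQ (proc net v))) →
           ((Fin m → ℕ) → Fin p → ℕ) → Set
Computes net s f =
  ∀ x → (∃ λ cfg → Star Step (initial {net = net} s x) cfg × Halted cfg)
      × (∀ cfg → Star Step (initial {net = net} s x) cfg → Halted cfg → ∀ j → outCount cfg j ≡ f x j)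

Emulates : ∀ {k l} → Network k l → (P : Processor k l) → Fin (nQ P) → Set
Emulates net P q = Σ ((v : Fin (N net)) → Fin (nQ (proc net v))) λ s → Computes net s (compute P q)

module Submission where

-- Feed x = T n letters to the network and look at the letter counts y read by the
-- node input wires in a halted run; they solve the inflow equations "what a wire reads is
-- what is sent to it".  We show that on such solutions every quantity of interest is
-- affine: for some scale T ≥ 1, slope α and error C it lies between α n and α n + C.
-- A recurrent component is exactly linear on multiples of a common period of its letters,
-- a presink emits at most one letter, and outputs are monotone in the inputs; so affine
-- inputs give affine outputs, and sums of affine quantities are affine.  Acyclicity lets
-- this propagate from the network input to every node and to the output.  But the
-- delayer outputs T n ∸ 1, and α n ≤ T n ∸ 1 ≤ α n + C for all n is impossible.

open import Defs
open import Data.Nat using (ℕ; zero; suc; _+_; _*_; _∸_; _≤_; _<_; z≤n; s≤s)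
open import Data.Nat.Properties hiding (_≟_)
open import Data.Nat.Divisibility using (_∣_; divides; ∣-trans; m∣m*n; n∣m*n)
open import Data.Nat.Tactic.RingSolver using (solve-∀)
open import Data.Fin using (Fin; zero; suc; _≟_; toℕ)
open import Data.Fin.Properties using (pigeonhole)
open import Data.List using (List; []; _∷_; _++_; concatMap; replicate; foldr; allFin; tabulate)
open import Data.List.Properties using (++-assoc; ++-identityʳ)
open import Data.Bool using (if_then_else_)
open import Data.Product using (Σ; _×_; _,_; proj₁; proj₂)
open import Data.Sum using (_⊎_; inj₁; inj₂)
open import Data.Empty using (⊥-elim)
open import Relation.Nullary using (¬_; yes; no; Dec)
open import Relation.Nullary.Decidable using (⌊_⌋)
open import Relation.Binary.PropositionalEquality
open import Level using (0ℓ)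
open import Relation.Binary.Bundles using (Setoid)
import Relation.Binary.Reasoning.Setoid as SetoidReasoning
open import Relation.Binary.Construct.Closure.Transitive using (TransClosure; [_]; _∷ʳ_)
open import Relation.Binary.Construct.Closure.ReflexiveTransitive using (Star; ε; _◅_)

sumL : ∀ {A : Set} → List A → (A → ℕ) → ℕ
sumL []      f = 0
sumL (x ∷ L) f = f x + sumL L f

sumL-cong : ∀ {A : Set} (L : List A) {f g : A → ℕ} → (∀ i → f i ≡ g i) → sumL L f ≡ sumL L g
sumL-cong []      eq = refl
sumL-cong (x ∷ L) eq = cong₂ _+_ (eq x) (sumL-cong L eq)

sumL-zero : ∀ {A : Set} (L : List A) → sumL L (λ _ → 0) ≡ 0
sumL-zero []      = refl
sumL-zero (x ∷ L) = sumL-zero L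

sumL-+ : ∀ {A : Set} (L : List A) (f g : A → ℕ) → sumL L (λ i → f i + g i) ≡ sumL L f + sumL L g
sumL-+ []      f g = refl
sumL-+ (x ∷ L) f g = trans (cong (f x + g x +_) (sumL-+ L f g)) (interchange (f x) (g x) _ _)
  where
  interchange : ∀ a b c d → a + b + (c + d) ≡ a + c + (b + d)
  interchange = solve-∀

sumL-*ʳ : ∀ {A : Set} (L : List A) (f : A → ℕ) m → sumL L (λ i → f i * m) ≡ sumL L f * m
sumL-*ʳ []      f m = refl
sumL-*ʳ (x ∷ L) f m = trans (cong (f x * m +_) (sumL-*ʳ L f m)) (sym (*-distribʳ-+ m (f x) _))

sumL-tabulate : ∀ {A B : Set} n (f : A → B) (g : Fin n → A) (h : B → ℕ) →
                sumL (tabulate (λ i → f (g i))) h ≡ sumL (tabulate g) (λ a → h (f a))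
sumL-tabulate zero    f g h = refl
sumL-tabulate (suc n) f g h = cong (h (f (g zero)) +_) (sumL-tabulate n f (λ i → g (suc i)) h)

δ : ∀ {n} → Fin n → Fin n → ℕ
δ c i = if ⌊ c ≟ i ⌋ then 1 else 0

δ-suc : ∀ {n} (c i : Fin n) → δ (suc c) (suc i) ≡ δ c i
δ-suc c i with c ≟ i
... | yes _ = refl
... | no _  = refl

δ-self : ∀ {n} (c : Fin n) → δ c c ≡ 1
δ-self c with c ≟ c
... | yes _   = refl
... | no c≢c  = ⊥-elim (c≢c refl)

δ-other : ∀ {n} (c i : Fin n) → ¬ c ≡ i → δ c i ≡ 0
δ-other c i c≢i with c ≟ i
... | yes c≡i = ⊥-elim (c≢i c≡i)
... | no _    = refl

sumL-δ : ∀ n (c : Fin n) → sumL (allFin n) (δ c) ≡ 1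
sumL-δ (suc n) zero    = cong suc (trans (sumL-tabulate n suc (λ i → i) (δ zero)) (sumL-zero (allFin n)))
sumL-δ (suc n) (suc c) = begin
  sumL (tabulate suc) (δ (suc c))              ≡⟨ sumL-tabulate n suc (λ i → i) (δ (suc c)) ⟩
  sumL (allFin n) (λ i → δ (suc c) (suc i))    ≡⟨ sumL-cong (allFin n) (δ-suc c) ⟩
  sumL (allFin n) (δ c)                        ≡⟨ sumL-δ n c ⟩
  1                                            ∎
  where open ≡-Reasoning

sumL-update : ∀ {n} (L : List (Fin n)) (f g : Fin n → ℕ) v m →
              f v ≡ g v + m → (∀ u → ¬ u ≡ v → f u ≡ g u) → sumL L f ≡ sumL L g + sumL L (δ v) * m
sumL-update []      f g v m fv fu = refl
sumL-update (i ∷ L) f g v m fv fu with v ≟ i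
... | yes refl = begin
  f v + sumL L f                              ≡⟨ cong₂ _+_ fv (sumL-update L f g v m fv fu) ⟩
  g v + m + (sumL L g + sumL L (δ v) * m)     ≡⟨ regroup (g v) m (sumL L g) (sumL L (δ v)) ⟩
  g v + sumL L g + (1 + sumL L (δ v)) * m     ∎
  where
  open ≡-Reasoning
  regroup : ∀ a m b k → a + m + (b + k * m) ≡ a + b + (1 + k) * m
  regroup = solve-∀
... | no v≢i = begin
  f i + sumL L f                              ≡⟨ cong₂ _+_ (fu i (λ i≡v → v≢i (sym i≡v))) (sumL-update L f g v m fv fu) ⟩
  g i + (sumL L g + sumL L (δ v) * m)         ≡⟨ sym (+-assoc (g i) _ _) ⟩
  g i + sumL L g + sumL L (δ v) * m           ∎
  where open ≡-Reasoning

commonMultiple : ∀ n (f : Fin n → ℕ) → (∀ i → 1 ≤ f i) → Σ ℕ λ T → 1 ≤ T × (∀ i → f i ∣ T)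
commonMultiple zero    f pos = 1 , ≤-refl , λ ()
commonMultiple (suc n) f pos with commonMultiple n (λ i → f (suc i)) (λ i → pos (suc i))
... | T , T≥1 , f∣T = f zero * T , *-mono-≤ (pos zero) T≥1 , divides-product
  where
  divides-product : ∀ i → f i ∣ f zero * T
  divides-product zero    = m∣m*n T
  divides-product (suc i) = ∣-trans (f∣T i) (n∣m*n (f zero))

replicate-+ : ∀ {A : Set} m n (a : A) → replicate (m + n) a ≡ replicate m a ++ replicate n a
replicate-+ zero    n a = refl
replicate-+ (suc m) n a = cong (a ∷_) (replicate-+ m n a)

wordOver : ∀ {k} → List (Fin k) → (Fin k → ℕ) → List (Fin k)
wordOver L y = concatMap (λ i → replicate (y i) i) L

wordOver-cong : ∀ {k} (L : List (Fin k)) {y y′ : Fin k → ℕ} → (∀ i → y i ≡ y′ i) → wordOver L y ≡ wordOver L y′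
wordOver-cong []      eq = refl
wordOver-cong (i ∷ L) eq = cong₂ _++_ (cong (λ n → replicate n i) (eq i)) (wordOver-cong L eq)

wordOver-zero : ∀ {k} (L : List (Fin k)) → wordOver L (λ _ → 0) ≡ []
wordOver-zero []      = refl
wordOver-zero (i ∷ L) = wordOver-zero L

wordOver-δ : ∀ {k} (L : List (Fin k)) c → wordOver L (δ c) ≡ replicate (sumL L (δ c)) c
wordOver-δ []      c = refl
wordOver-δ (i ∷ L) c with c ≟ i
... | yes refl = cong (c ∷_) (wordOver-δ L c)
... | no _     = wordOver-δ L c

module Abelian {k l} (P : Processor k l) where

  Word : Set
  Word = List (Fin k)

  State : Set
  State = Fin (nQ P)

  state-++ : ∀ U W q → runState P (U ++ W) q ≡ runState P W (runState P U q)
  state-++ []      W q = refl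
  state-++ (a ∷ U) W q = state-++ U W (t P a q)

  out-++ : ∀ U W q b → runOut P (U ++ W) q b ≡ runOut P U q b + runOut P W (runState P U q) b
  out-++ []      W q b = refl
  out-++ (a ∷ U) W q b = trans (cong (o P a q b +_) (out-++ U W (t P a q) b)) (sym (+-assoc (o P a q b) _ _))

  record _≈_ (U V : Word) : Set where
    constructor equiv
    field
      same-state : ∀ q → runState P U q ≡ runState P V q
      same-out   : ∀ q b → runOut P U q b ≡ runOut P V q b
  open _≈_ public

  ≈-setoid : Setoid 0ℓ 0ℓ
  ≈-setoid = record
    { Carrier = Word
    ; _≈_ = _≈_
    ; isEquivalence = record
      { refl  = equiv (λ q → refl) (λ q b → refl)
      ; sym   = λ U≈V → equiv (λ q → sym (same-state U≈V q)) (λ q b → sym (same-out U≈V q b))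
      ; trans = λ U≈V V≈W → equiv (λ q → trans (same-state U≈V q) (same-state V≈W q))
                                  (λ q b → trans (same-out U≈V q b) (same-out V≈W q b))
      }
    }

  open Setoid ≈-setoid public using () renaming (refl to ≈-refl; reflexive to ≈-reflexive)
  module ≈-Reasoning = SetoidReasoning ≈-setoid

  ≈-++ʳ : ∀ {U V} W → U ≈ V → (U ++ W) ≈ (V ++ W)
  ≈-++ʳ {U} {V} W U≈V = equiv
    (λ q → trans (state-++ U W q) (trans (cong (runState P W) (same-state U≈V q)) (sym (state-++ V W q))))
    (λ q b → trans (out-++ U W q b)
               (trans (cong₂ _+_ (same-out U≈V q b) (cong (λ r → runOut P W r b) (same-state U≈V q)))
                      (sym (out-++ V W q b))))

  ≈-++ˡ : ∀ {U V} W → U ≈ V → (W ++ U) ≈ (W ++ V)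
  ≈-++ˡ {U} {V} W U≈V = equiv
    (λ q → trans (state-++ W U q) (trans (same-state U≈V _) (sym (state-++ W V q))))
    (λ q b → trans (out-++ W U q b) (trans (cong (runOut P W q b +_) (same-out U≈V _ b)) (sym (out-++ W V q b))))

  swap-letters : ∀ a c → (a ∷ c ∷ []) ≈ (c ∷ a ∷ [])
  swap-letters a c = equiv (λ q → comm P c a q) swapped-out
    where
    swapped-out : ∀ q b → runOut P (a ∷ c ∷ []) q b ≡ runOut P (c ∷ a ∷ []) q b
    swapped-out q b rewrite +-identityʳ (o P c (t P a q) b) | +-identityʳ (o P a (t P c q) b) = outAb P a c q b

  letter-to-end : ∀ a U → (a ∷ U) ≈ (U ++ a ∷ [])
  letter-to-end a []      = ≈-refl
  letter-to-end a (c ∷ U) = begin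
    a ∷ c ∷ U          ≈⟨ ≈-++ʳ U (swap-letters a c) ⟩
    c ∷ a ∷ U          ≈⟨ ≈-++ˡ (c ∷ []) (letter-to-end a U) ⟩
    c ∷ U ++ a ∷ []    ∎
    where open ≈-Reasoning

  ++-comm-≈ : ∀ U V → (U ++ V) ≈ (V ++ U)
  ++-comm-≈ []      V = ≈-reflexive (sym (++-identityʳ V))
  ++-comm-≈ (a ∷ U) V = begin
    a ∷ U ++ V           ≈⟨ ≈-++ˡ (a ∷ []) (++-comm-≈ U V) ⟩
    a ∷ V ++ U           ≈⟨ ≈-++ʳ U (letter-to-end a V) ⟩
    (V ++ a ∷ []) ++ U   ≡⟨ ++-assoc V (a ∷ []) U ⟩
    V ++ a ∷ U           ∎
    where open ≈-Reasoning

  wordOver-+ : ∀ L y d → wordOver L (λ i → y i + d i) ≈ (wordOver L y ++ wordOver L d)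
  wordOver-+ []      y d = ≈-refl
  wordOver-+ (i ∷ L) y d = begin
    replicate (y i + d i) i ++ wordOver L (λ j → y j + d j)
      ≡⟨ cong (_++ wordOver L (λ j → y j + d j)) (replicate-+ (y i) (d i) i) ⟩
    (Yi ++ Di) ++ wordOver L (λ j → y j + d j)
      ≈⟨ ≈-++ˡ (Yi ++ Di) (wordOver-+ L y d) ⟩
    (Yi ++ Di) ++ (wordOver L y ++ wordOver L d)
      ≡⟨ regroup Yi Di (wordOver L y) (wordOver L d) ⟩
    Yi ++ (Di ++ wordOver L y) ++ wordOver L d
      ≈⟨ ≈-++ˡ Yi (≈-++ʳ (wordOver L d) (++-comm-≈ Di (wordOver L y))) ⟩
    Yi ++ (wordOver L y ++ Di) ++ wordOver L d
      ≡⟨ regroup Yi (wordOver L y) Di (wordOver L d) ⟨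
    (Yi ++ wordOver L y) ++ (Di ++ wordOver L d)
      ∎
    where
    open ≈-Reasoning
    Yi : Word
    Yi = replicate (y i) i
    Di : Word
    Di = replicate (d i) i
    regroup : ∀ (A B C D : Word) → (A ++ B) ++ (C ++ D) ≡ A ++ (B ++ C) ++ D
    regroup A B C D = trans (++-assoc A B (C ++ D)) (cong (A ++_) (sym (++-assoc B C D)))

  wordOf-snoc : ∀ y y′ c → (∀ i → y′ i ≡ y i + δ c i) → wordOf y′ ≈ (wordOf y ++ c ∷ [])
  wordOf-snoc y y′ c y′≡ = begin
    wordOf y′                                            ≡⟨ wordOver-cong (allFin k) y′≡ ⟩
    wordOver (allFin k) (λ i → y i + δ c i)              ≈⟨ wordOver-+ (allFin k) y (δ c) ⟩
    wordOf y ++ wordOver (allFin k) (δ c)                ≡⟨ cong (wordOf y ++_) (wordOver-δ (allFin k) c) ⟩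
    wordOf y ++ replicate (sumL (allFin k) (δ c)) c      ≡⟨ cong (λ n → wordOf y ++ replicate n c) (sumL-δ k c) ⟩
    wordOf y ++ c ∷ []                                   ∎
    where open ≈-Reasoning

  -- Output is monotone in the letter counts: wordOf y = wordOf y′ followed by the rest.
  wordOf-mono : ∀ y′ y → (∀ i → y′ i ≤ y i) → ∀ q b → runOut P (wordOf y′) q b ≤ runOut P (wordOf y) q b
  wordOf-mono y′ y y′≤y q b = begin
    runOut P (wordOf y′) q b                                           ≤⟨ m≤m+n _ _ ⟩
    runOut P (wordOf y′) q b + runOut P rest (runState P (wordOf y′) q) b ≡⟨ out-++ (wordOf y′) rest q b ⟨
    runOut P (wordOf y′ ++ rest) q b                                   ≡⟨ same-out (wordOver-+ (allFin k) y′ d) q b ⟨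
    runOut P (wordOver (allFin k) (λ i → y′ i + d i)) q b              ≡⟨ cong (λ W → runOut P W q b) (wordOver-cong (allFin k) (λ i → m+[n∸m]≡n (y′≤y i))) ⟩
    runOut P (wordOf y) q b                                            ∎
    where
    open ≤-Reasoning
    d : Fin k → ℕ
    d = λ i → y i ∸ y′ i
    rest : Word
    rest = wordOver (allFin k) d

  state-comm : ∀ U W q → runState P W (runState P U q) ≡ runState P U (runState P W q)
  state-comm U W q = trans (sym (state-++ U W q)) (trans (same-state (++-comm-≈ U W) q) (state-++ W U q))

  -- In a recurrent processor every letter, repeated often enough, leads back to the start:
  -- two of the states q, a q, …, a^|Q| q coincide, say a^i q = a^j q with i < j, and a word
  -- w with w a^i q = q shows a^(j-i) q = w a^(j-i) a^i q = w a^j q = w a^i q = q.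
  letter-period : Recurrent P → ∀ q a → Σ ℕ λ n → 1 ≤ n × runState P (replicate n a) q ≡ q
  letter-period rec q a
    with i , j , i<j , aⁱq≡aʲq ← pigeonhole (n<1+n (nQ P)) (λ (i : Fin (suc (nQ P))) → runState P (replicate (toℕ i) a) q)
    with w , w-returns ← rec (runState P (replicate (toℕ i) a) q) q
    = toℕ j ∸ toℕ i , m<n⇒0<n∸m i<j , returns
    where
    open ≡-Reasoning
    aⁱ : Word
    aⁱ = replicate (toℕ i) a
    aᵈ : Word
    aᵈ = replicate (toℕ j ∸ toℕ i) a
    returns : runState P aᵈ q ≡ q
    returns = begin
      runState P aᵈ q                                   ≡⟨ cong (runState P aᵈ) w-returns ⟨
      runState P aᵈ (runState P w (runState P aⁱ q))    ≡⟨ state-comm w aᵈ _ ⟩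
      runState P w (runState P aᵈ (runState P aⁱ q))    ≡⟨ cong (runState P w) (state-++ aⁱ aᵈ q) ⟨
      runState P w (runState P (aⁱ ++ aᵈ) q)            ≡⟨ cong (λ W → runState P w (runState P W q)) (replicate-+ (toℕ i) _ a) ⟨
      runState P w (runState P (replicate (toℕ i + (toℕ j ∸ toℕ i)) a) q)
        ≡⟨ cong (λ n → runState P w (runState P (replicate n a) q)) (m+[n∸m]≡n (<⇒≤ i<j)) ⟩
      runState P w (runState P (replicate (toℕ j) a) q) ≡⟨ cong (runState P w) aⁱq≡aʲq ⟨
      runState P w (runState P aⁱ q)                    ≡⟨ w-returns ⟩
      q                                                 ∎

  Loop : State → Word → (Fin l → ℕ) → Set
  Loop q W c = runState P W q ≡ q × (∀ b → runOut P W q b ≡ c b)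

  loop-++ : ∀ {q U W c d} → Loop q U c → Loop q W d → Loop q (U ++ W) (λ b → c b + d b)
  loop-++ {q} {U} {W} (U-returns , U-out) (W-returns , W-out) =
    trans (state-++ U W q) (trans (cong (runState P W) U-returns) W-returns) ,
    λ b → trans (out-++ U W q b) (cong₂ _+_ (U-out b) (trans (cong (λ r → runOut P W r b) U-returns) (W-out b)))

  loop-replicate : ∀ {q a c} n → Loop q (replicate n a) c → ∀ j → Loop q (replicate (j * n) a) (λ b → j * c b)
  loop-replicate         n loop zero    = refl , λ b → refl
  loop-replicate {q} {a} n loop (suc j) =
    subst (λ W → Loop q W _) (sym (replicate-+ n (j * n) a)) (loop-++ {U = replicate n a} loop (loop-replicate n loop j))

  loop-wordOver : ∀ {q} N (c : Fin k → Fin l → ℕ) → (∀ a → Loop q (replicate N a) (c a)) →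
                  ∀ L (z : Fin k → ℕ) → Loop q (wordOver L (λ i → z i * N)) (λ b → sumL L (λ i → z i * c i b))
  loop-wordOver N c loops []      z = refl , λ b → refl
  loop-wordOver N c loops (a ∷ L) z = loop-++ {U = replicate (z a * N) a} {W = wordOver L (λ i → z i * N)}
    (loop-replicate N (loops a) (z a)) (loop-wordOver N c loops L z)

record EventuallyLinear {k l} (P : Processor k l) (q : Fin (nQ P)) : Set where
  field
    period   : ℕ
    period≥1 : 1 ≤ period
    rate     : Fin k → Fin l → ℕ
    slack    : Fin l → ℕ
    lower    : ∀ (z : Fin k → ℕ) b → sumL (allFin k) (λ i → z i * rate i b) ≤ runOut P (wordOf (λ i → z i * period)) q b
    upper    : ∀ (z : Fin k → ℕ) b → runOut P (wordOf (λ i → z i * period)) q b ≤ sumL (allFin k) (λ i → z i * rate i b) + slack b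

-- A recurrent processor is exactly linear on multiples of a common period of all letters.
recurrent-linear : ∀ {k l} (P : Processor k l) → Recurrent P → ∀ q → EventuallyLinear P q
recurrent-linear {k} P rec q = record
  { period   = T
  ; period≥1 = T≥1
  ; rate     = λ a b → runOut P (replicate T a) q b
  ; slack    = λ _ → 0
  ; lower    = λ z b → ≤-reflexive (sym (output z b))
  ; upper    = λ z b → ≤-trans (≤-reflexive (output z b)) (m≤m+n _ 0)
  }
  where
  open Abelian P
  n : Fin k → ℕ
  n a = proj₁ (letter-period rec q a)
  n≥1 : ∀ a → 1 ≤ n a
  n≥1 a = proj₁ (proj₂ (letter-period rec q a))
  aⁿ-returns : ∀ a → runState P (replicate (n a) a) q ≡ q
  aⁿ-returns a = proj₂ (proj₂ (letter-period rec q a))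
  common : Σ ℕ λ T → 1 ≤ T × (∀ a → n a ∣ T)
  common = commonMultiple k n n≥1
  T : ℕ
  T = proj₁ common
  T≥1 : 1 ≤ T
  T≥1 = proj₁ (proj₂ common)
  returns : ∀ a → runState P (replicate T a) q ≡ q
  returns a with divides j T≡j*n ← proj₂ (proj₂ common) a =
    subst (λ m → runState P (replicate m a) q ≡ q) (sym T≡j*n)
          (proj₁ (loop-replicate (n a) (aⁿ-returns a , λ b → refl) j))
  output : ∀ z b → runOut P (wordOf (λ i → z i * T)) q b ≡ sumL (allFin k) (λ i → z i * runOut P (replicate T i) q b)
  output z b = proj₂ (loop-wordOver T _ (λ a → returns a , λ b → refl) (allFin k) z) b

-- A presink emits at most one letter in total.
presink-linear : ∀ q → EventuallyLinear presink q
presink-linear q = record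
  { period   = 1
  ; period≥1 = ≤-refl
  ; rate     = λ _ _ → 0
  ; slack    = λ _ → 1
  ; lower    = λ z b → ≤-trans (≤-reflexive (no-rate z)) z≤n
  ; upper    = upper
  }
  where
  silent : ∀ w b → runOut presink w (suc zero) b ≡ 0
  silent []      b = refl
  silent (a ∷ w) b = silent w b
  at-most-one : ∀ w q b → runOut presink w q b ≤ 1
  at-most-one []      q          b = z≤n
  at-most-one (a ∷ w) zero       b = ≤-reflexive (cong suc (silent w b))
  at-most-one (a ∷ w) (suc zero) b = ≤-trans (≤-reflexive (silent w b)) z≤n
  no-rate : ∀ (z : Fin 1 → ℕ) → sumL (allFin 1) (λ i → z i * 0) ≡ 0
  no-rate z = trans (+-identityʳ (z zero * 0)) (*-zeroʳ (z zero))
  upper : ∀ (z : Fin 1 → ℕ) b → runOut presink (wordOf (λ i → z i * 1)) q b ≤ sumL (allFin 1) (λ i → z i * 0) + 1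
  upper z b = ≤-trans (at-most-one (wordOf (λ i → z i * 1)) q b) (m≤n+m 1 _)

component-linear : ∀ {k l} (C : Component k l) q → EventuallyLinear (procOf C) q
component-linear (recurrentC P rec) q = recurrent-linear P rec q
component-linear presinkC           q = presink-linear q

module Execution {m p} (net : Network m p) (s : (v : Fin (N net)) → Fin (nQ (proc net v))) where

  Node : Set
  Node = Fin (N net)

  Target : Set
  Target = Dest (N net) p (ins net)

  -- number of letters read so far on each node input wire
  Counts : Set
  Counts = (v : Node) → Fin (ins net v) → ℕ

  nodeState : (v : Node) → (Fin (ins net v) → ℕ) → Fin (nQ (proc net v))
  nodeState v z = runState (proc net v) (wordOf z) (s v)

  nodeOut : (v : Node) → (Fin (ins net v) → ℕ) → Fin (outs net v) → ℕ
  nodeOut v z = runOut (proc net v) (wordOf z) (s v)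

  module _ (v : Node) where
    open Abelian (proc net v)

    nodeState-step : ∀ (z z′ : Fin (ins net v) → ℕ) a → (∀ c → z′ c ≡ z c + δ a c) →
                     nodeState v z′ ≡ t (proc net v) a (nodeState v z)
    nodeState-step z z′ a z′≡ = trans (same-state (wordOf-snoc z z′ a z′≡) (s v)) (state-++ (wordOf z) (a ∷ []) (s v))

    nodeOut-step : ∀ (z z′ : Fin (ins net v) → ℕ) a → (∀ c → z′ c ≡ z c + δ a c) → ∀ b →
                   nodeOut v z′ b ≡ nodeOut v z b + o (proc net v) a (nodeState v z) b
    nodeOut-step z z′ a z′≡ b = trans (same-out (wordOf-snoc z z′ a z′≡) (s v) b)
      (trans (out-++ (wordOf z) (a ∷ []) (s v) b) (cong (nodeOut v z b +_) (+-identityʳ _)))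

  hits : Target → Target → ℕ
  hits (toOut j)    (toOut j′)   = δ j j′
  hits (toOut _)    (toNode _ _) = 0
  hits (toNode _ _) (toOut _)    = 0
  hits (toNode w c) (toNode v a) with w ≟ v
  ... | yes refl = δ c a
  ... | no _     = 0

  hits-same : ∀ v (a c : Fin (ins net v)) → hits (toNode v a) (toNode v c) ≡ δ a c
  hits-same v a c with v ≟ v
  ... | yes refl = refl
  ... | no v≢v   = ⊥-elim (v≢v refl)

  hits-apart : ∀ v w (a : Fin (ins net v)) (c : Fin (ins net w)) → ¬ v ≡ w → hits (toNode v a) (toNode w c) ≡ 0
  hits-apart v w a c v≢w with v ≟ w
  ... | yes v≡w = ⊥-elim (v≢w v≡w)
  ... | no _    = refl

  received : Config net → Target → ℕ
  received cfg (toOut j)    = outCount cfg j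
  received cfg (toNode v a) = pend cfg v a

  addAt-hits : ∀ (f : Counts) w c n v a → addAt {net = net} f w c n v a ≡ f v a + hits (toNode w c) (toNode v a) * n
  addAt-hits f w c n v a with w ≟ v
  ... | no _     = sym (+-identityʳ _)
  ... | yes refl with c ≟ a
  ...   | yes _ = cong (f v a +_) (sym (+-identityʳ n))
  ...   | no _  = sym (+-identityʳ _)

  addOut-hits : ∀ (f : Fin p → ℕ) j n j′ → addOut {net = net} f j n j′ ≡ f j′ + δ j j′ * n
  addOut-hits f j n j′ with j ≟ j′
  ... | yes _ = cong (f j′ +_) (sym (+-identityʳ n))
  ... | no _  = sym (+-identityʳ _)

  deliver-received : ∀ d n (cfg : Config net) d′ → received (deliver d n cfg) d′ ≡ received cfg d′ + hits d d′ * n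
  deliver-received (toOut j)    n cfg (toOut j′)   = addOut-hits (outCount cfg) j n j′
  deliver-received (toOut j)    n cfg (toNode v a) = sym (+-identityʳ _)
  deliver-received (toNode w c) n cfg (toOut j)    = sym (+-identityʳ _)
  deliver-received (toNode w c) n cfg (toNode v a) = addAt-hits (pend cfg) w c n v a

  deliver-state : ∀ d n (cfg : Config net) → state (deliver d n cfg) ≡ state cfg
  deliver-state (toOut _)    n cfg = refl
  deliver-state (toNode _ _) n cfg = refl

  deliver-extPend : ∀ d n (cfg : Config net) → extPend (deliver d n cfg) ≡ extPend cfg
  deliver-extPend (toOut _)    n cfg = refl
  deliver-extPend (toNode _ _) n cfg = refl

  sendAll : (v : Node) → (Fin (outs net v) → ℕ) → List (Fin (outs net v)) → Config net → Config net
  sendAll v O L cfg = foldr (λ b → deliver (wire net v b) (O b)) cfg L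

  sendAll-received : ∀ v O L (cfg : Config net) d →
                     received (sendAll v O L cfg) d ≡ received cfg d + sumL L (λ b → hits (wire net v b) d * O b)
  sendAll-received v O []      cfg d = sym (+-identityʳ _)
  sendAll-received v O (b ∷ L) cfg d = begin
    received (deliver (wire net v b) (O b) (sendAll v O L cfg)) d   ≡⟨ deliver-received (wire net v b) (O b) _ d ⟩
    received (sendAll v O L cfg) d + Hb                             ≡⟨ cong (_+ Hb) (sendAll-received v O L cfg d) ⟩
    received cfg d + Rest + Hb                                      ≡⟨ +-assoc (received cfg d) Rest Hb ⟩
    received cfg d + (Rest + Hb)                                    ≡⟨ cong (received cfg d +_) (+-comm Rest Hb) ⟩
    received cfg d + (Hb + Rest)                                    ∎
    where
    open ≡-Reasoning
    Hb : ℕ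
    Hb = hits (wire net v b) d * O b
    Rest : ℕ
    Rest = sumL L (λ b → hits (wire net v b) d * O b)

  sendAll-state : ∀ v O L (cfg : Config net) → state (sendAll v O L cfg) ≡ state cfg
  sendAll-state v O []      cfg = refl
  sendAll-state v O (b ∷ L) cfg = trans (deliver-state (wire net v b) (O b) _) (sendAll-state v O L cfg)

  sendAll-extPend : ∀ v O L (cfg : Config net) → extPend (sendAll v O L cfg) ≡ extPend cfg
  sendAll-extPend v O []      cfg = refl
  sendAll-extPend v O (b ∷ L) cfg = trans (deliver-extPend (wire net v b) (O b) _) (sendAll-extPend v O L cfg)

  -- Letters sent to d by the network inputs, after e i letters entered on input wire i,
  -- and by node u, after its input wires read the counts y u.
  fromInputs : Target → (Fin m → ℕ) → ℕ
  fromInputs d e = sumL (allFin m) (λ i → e i * hits (inWire net i) d)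

  fromNode : Target → Counts → Node → ℕ
  fromNode d y u = sumL (allFin (outs net u)) (λ b → hits (wire net u b) d * nodeOut u (y u) b)

  inflow : Target → (Fin m → ℕ) → Counts → ℕ
  inflow d e y = fromInputs d e + sumL (allFin (N net)) (fromNode d y)

  -- Every reachable configuration is described by the letters e taken from the network
  -- inputs and the letters y read by the nodes: states are determined by y, and what
  -- arrived at each destination is what was sent there.
  record Invariant (X : Fin m → ℕ) (cfg : Config net) (e : Fin m → ℕ) (y : Counts) : Set where
    field
      ext-pending : ∀ i → extPend cfg i + e i ≡ X i
      node-state  : ∀ v → state cfg v ≡ nodeState v (y v)
      pending     : ∀ v a → pend cfg v a + y v a ≡ inflow (toNode v a) e y
      output      : ∀ j → outCount cfg j ≡ inflow (toOut j) e y
  open Invariant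

  inflow-initial : ∀ d → inflow d (λ _ → 0) (λ _ _ → 0) ≡ 0
  inflow-initial d = cong₂ _+_ (sumL-zero (allFin m)) (trans (sumL-cong (allFin (N net)) silent) (sumL-zero (allFin (N net))))
    where
    silent : ∀ u → fromNode d (λ _ _ → 0) u ≡ 0
    silent u = trans (sumL-cong (allFin (outs net u)) (λ b →
                 trans (cong (λ W → hits (wire net u b) d * runOut (proc net u) W (s u) b) (wordOver-zero (allFin (ins net u))))
                       (*-zeroʳ (hits (wire net u b) d))))
               (sumL-zero (allFin (outs net u)))

  invariant-initial : ∀ X → Invariant X (initial s X) (λ _ → 0) (λ _ _ → 0)
  invariant-initial X = record
    { ext-pending = λ i → +-identityʳ (X i)
    ; node-state  = λ v → cong (λ W → runState (proc net v) W (s v)) (sym (wordOver-zero (allFin (ins net v))))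
    ; pending     = λ v a → sym (inflow-initial (toNode v a))
    ; output      = λ j → sym (inflow-initial (toOut j))
    }

  inflow-input : ∀ d e y i → inflow d (λ j → e j + δ i j) y ≡ inflow d e y + hits (inWire net i) d
  inflow-input d e y i = begin
    fromInputs d e′ + fromNodes                                         ≡⟨ cong (_+ fromNodes) (sumL-update (allFin m) _ _ i h at-i elsewhere) ⟩
    fromInputs d e + sumL (allFin m) (δ i) * h + fromNodes              ≡⟨ cong (λ k → fromInputs d e + k * h + fromNodes) (sumL-δ m i) ⟩
    fromInputs d e + 1 * h + fromNodes                                  ≡⟨ regroup (fromInputs d e) h fromNodes ⟩
    fromInputs d e + fromNodes + h                                      ∎
    where
    open ≡-Reasoning
    e′ : Fin m → ℕ
    e′ = λ j → e j + δ i j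
    h : ℕ
    h = hits (inWire net i) d
    fromNodes : ℕ
    fromNodes = sumL (allFin (N net)) (fromNode d y)
    at-i : e′ i * h ≡ e i * h + h
    at-i = begin
      (e i + δ i i) * h    ≡⟨ cong (λ x → (e i + x) * h) (δ-self i) ⟩
      (e i + 1) * h        ≡⟨ *-distribʳ-+ h (e i) 1 ⟩
      e i * h + 1 * h      ≡⟨ cong (e i * h +_) (*-identityˡ h) ⟩
      e i * h + h          ∎
    elsewhere : ∀ j → ¬ j ≡ i → e′ j * hits (inWire net j) d ≡ e j * hits (inWire net j) d
    elsewhere j j≢i = cong (λ x → x * hits (inWire net j) d)
                        (trans (cong (e j +_) (δ-other i j (λ i≡j → j≢i (sym i≡j)))) (+-identityʳ (e j)))
    regroup : ∀ a h n → a + 1 * h + n ≡ a + n + h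
    regroup = solve-∀

  emitted : (v : Node) → Fin (ins net v) → Fin (nQ (proc net v)) → Target → ℕ
  emitted v a q d = sumL (allFin (outs net v)) (λ b → hits (wire net v b) d * o (proc net v) a q b)

  module OneMoreLetter (y : Counts) (v : Node) (a : Fin (ins net v)) where

    y⁺ : Counts
    y⁺ = addAt {net = net} y v a 1

    y⁺-here : ∀ c → y⁺ v c ≡ y v c + δ a c
    y⁺-here c = trans (addAt-hits y v a 1 v c) (cong (y v c +_) (trans (*-identityʳ _) (hits-same v a c)))

    y⁺-elsewhere : ∀ u → ¬ v ≡ u → ∀ c → y⁺ u c ≡ y u c
    y⁺-elsewhere u v≢u c =
      trans (addAt-hits y v a 1 u c) (trans (cong (λ x → y u c + x * 1) (hits-apart v u a c v≢u)) (+-identityʳ _))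

    inflow-node : ∀ d e → inflow d e y⁺ ≡ inflow d e y + emitted v a (nodeState v (y v)) d
    inflow-node d e = begin
      fromInputs d e + sumL Nodes (fromNode d y⁺)                               ≡⟨ cong (fromInputs d e +_) (sumL-update Nodes _ _ v E at-v elsewhere) ⟩
      fromInputs d e + (sumL Nodes (fromNode d y) + sumL Nodes (δ v) * E)       ≡⟨ cong (λ k → fromInputs d e + (sumL Nodes (fromNode d y) + k * E)) (sumL-δ (N net) v) ⟩
      fromInputs d e + (sumL Nodes (fromNode d y) + 1 * E)                      ≡⟨ regroup (fromInputs d e) (sumL Nodes (fromNode d y)) E ⟩
      fromInputs d e + sumL Nodes (fromNode d y) + E                            ∎
      where
      open ≡-Reasoning
      Nodes : List Node
      Nodes = allFin (N net)
      E : ℕ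
      E = emitted v a (nodeState v (y v)) d
      at-v : fromNode d y⁺ v ≡ fromNode d y v + E
      at-v = trans (sumL-cong (allFin (outs net v)) (λ b →
                      trans (cong (hits (wire net v b) d *_) (nodeOut-step v (y v) (y⁺ v) a y⁺-here b))
                            (*-distribˡ-+ (hits (wire net v b) d) _ _)))
                   (sumL-+ (allFin (outs net v)) _ _)
      elsewhere : ∀ u → ¬ u ≡ v → fromNode d y⁺ u ≡ fromNode d y u
      elsewhere u u≢v = sumL-cong (allFin (outs net u)) (λ b →
        cong (λ W → hits (wire net u b) d * runOut (proc net u) W (s u) b)
             (wordOver-cong (allFin (ins net u)) (y⁺-elsewhere u (λ v≡u → u≢v (sym v≡u)))))
      regroup : ∀ a b e → a + (b + 1 * e) ≡ a + b + e
      regroup = solve-∀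

  decExt-δ : ∀ (f : Fin m → ℕ) i {n} → f i ≡ suc n → ∀ j → decExt {net = net} f i j + δ i j ≡ f j
  decExt-δ f i {n} fi≡ j with i ≟ j
  ... | yes refl = trans (cong (λ x → x ∸ 1 + 1) fi≡) (trans (+-comm n 1) (sym fi≡))
  ... | no _     = +-identityʳ (f j)

  decAt-hits : ∀ (f : Counts) v a {n} → f v a ≡ suc n → ∀ w c → decAt {net = net} f v a w c + hits (toNode v a) (toNode w c) ≡ f w c
  decAt-hits f v a {n} fva≡ w c with v ≟ w
  ... | no _     = +-identityʳ _
  ... | yes refl with a ≟ c
  ...   | yes refl = trans (cong (λ x → x ∸ 1 + 1) fva≡) (trans (+-comm n 1) (sym fva≡))
  ...   | no _     = +-identityʳ _

  setState-here : ∀ (f : (v : Node) → Fin (nQ (proc net v))) v q → setState {net = net} f v q v ≡ q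
  setState-here f v q with v ≟ v
  ... | yes refl = refl
  ... | no v≢v   = ⊥-elim (v≢v refl)

  setState-elsewhere : ∀ (f : (v : Node) → Fin (nQ (proc net v))) v q u → ¬ v ≡ u → setState {net = net} f v q u ≡ f u
  setState-elsewhere f v q u v≢u with v ≟ u
  ... | yes v≡u = ⊥-elim (v≢u v≡u)
  ... | no _    = refl

  invariant-input : ∀ {X cfg e y} i {n} → extPend cfg i ≡ suc n → Invariant X cfg e y →
                    Invariant X (deliver (inWire net i) 1 (record cfg { extPend = decExt {net = net} (extPend cfg) i }))
                                (λ j → e j + δ i j) y
  invariant-input {X} {cfg} {e} {y} i cfg-i≡ I = record
    { ext-pending = ext-pending′
    ; node-state  = λ v → trans (cong (λ f → f v) (deliver-state (inWire net i) 1 taken)) (node-state I v)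
    ; pending     = pending′
    ; output      = λ j → trans (deliver-received (inWire net i) 1 taken (toOut j))
                        (trans (cong₂ _+_ (output I j) (*-identityʳ _)) (sym (inflow-input (toOut j) e y i)))
    }
    where
    open ≡-Reasoning
    taken : Config net
    taken = record cfg { extPend = decExt {net = net} (extPend cfg) i }
    after : Config net
    after = deliver (inWire net i) 1 taken
    ext-pending′ : ∀ j → extPend after j + (e j + δ i j) ≡ X j
    ext-pending′ j = begin
      extPend after j + (e j + δ i j)                  ≡⟨ cong (λ f → f j + (e j + δ i j)) (deliver-extPend (inWire net i) 1 taken) ⟩
      decExt {net = net} (extPend cfg) i j + (e j + δ i j) ≡⟨ +-comm-middle (decExt {net = net} (extPend cfg) i j) (e j) (δ i j) ⟩
      decExt {net = net} (extPend cfg) i j + δ i j + e j   ≡⟨ cong (_+ e j) (decExt-δ (extPend cfg) i cfg-i≡ j) ⟩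
      extPend cfg j + e j                              ≡⟨ ext-pending I j ⟩
      X j                                              ∎
      where
      +-comm-middle : ∀ a b c → a + (b + c) ≡ a + c + b
      +-comm-middle = solve-∀
    pending′ : ∀ v a → pend after v a + y v a ≡ inflow (toNode v a) (λ j → e j + δ i j) y
    pending′ v a = begin
      pend after v a + y v a                   ≡⟨ cong (_+ y v a) (deliver-received (inWire net i) 1 taken (toNode v a)) ⟩
      pend cfg v a + h * 1 + y v a             ≡⟨ regroup (pend cfg v a) h (y v a) ⟩
      pend cfg v a + y v a + h                 ≡⟨ cong (_+ h) (pending I v a) ⟩
      inflow (toNode v a) e y + h              ≡⟨ inflow-input (toNode v a) e y i ⟨
      inflow (toNode v a) (λ j → e j + δ i j) y ∎
      where
      h : ℕ
      h = hits (inWire net i) (toNode v a)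
      regroup : ∀ p h y → p + h * 1 + y ≡ p + y + h
      regroup = solve-∀

  invariant-node : ∀ {X cfg e y} v a {n} → pend cfg v a ≡ suc n → Invariant X cfg e y →
                   Invariant X (emit v a (state cfg v)
                                  (record cfg { pend  = decAt {net = net} (pend cfg) v a
                                              ; state = setState {net = net} (state cfg) v (t (proc net v) a (state cfg v)) }))
                               e (OneMoreLetter.y⁺ y v a)
  invariant-node {X} {cfg} {e} {y} v a cfg-va≡ I = record
    { ext-pending = λ i → trans (cong (λ f → f i + e i) (sendAll-extPend v O (allFin (outs net v)) read)) (ext-pending I i)
    ; node-state  = λ u → trans (cong (λ f → f u) (sendAll-state v O (allFin (outs net v)) read)) (state′ u (v ≟ u))
    ; pending     = pending′
    ; output      = λ j → begin
        received after (toOut j)                ≡⟨ sendAll-received v O (allFin (outs net v)) read (toOut j) ⟩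
        outCount cfg j + emitted v a q (toOut j) ≡⟨ cong₂ _+_ (output I j) (cong (λ r → emitted v a r (toOut j)) (node-state I v)) ⟩
        inflow (toOut j) e y + E (toOut j)      ≡⟨ inflow-node (toOut j) e ⟨
        inflow (toOut j) e y⁺                   ∎
    }
    where
    open ≡-Reasoning
    open OneMoreLetter y v a
    q : Fin (nQ (proc net v))
    q = state cfg v
    O : Fin (outs net v) → ℕ
    O = o (proc net v) a q
    E : Target → ℕ
    E = emitted v a (nodeState v (y v))
    read : Config net
    read = record cfg { pend  = decAt {net = net} (pend cfg) v a
                      ; state = setState {net = net} (state cfg) v (t (proc net v) a q) }
    after : Config net
    after = emit v a q read
    state′ : ∀ u → Dec (v ≡ u) → setState {net = net} (state cfg) v (t (proc net v) a q) u ≡ nodeState u (y⁺ u)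
    state′ u (yes refl) = begin
      setState {net = net} (state cfg) v (t (proc net v) a q) v ≡⟨ setState-here (state cfg) v _ ⟩
      t (proc net v) a q                                        ≡⟨ cong (t (proc net v) a) (node-state I v) ⟩
      t (proc net v) a (nodeState v (y v))                      ≡⟨ nodeState-step v (y v) (y⁺ v) a y⁺-here ⟨
      nodeState v (y⁺ v)                                        ∎
    state′ u (no v≢u) = begin
      setState {net = net} (state cfg) v (t (proc net v) a q) u ≡⟨ setState-elsewhere (state cfg) v _ u v≢u ⟩
      state cfg u                                               ≡⟨ node-state I u ⟩
      nodeState u (y u)                                         ≡⟨ cong (λ W → runState (proc net u) W (s u)) (wordOver-cong (allFin (ins net u)) (y⁺-elsewhere u v≢u)) ⟨
      nodeState u (y⁺ u)                                        ∎
    pending′ : ∀ w c → pend after w c + y⁺ w c ≡ inflow (toNode w c) e y⁺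
    pending′ w c = begin
      pend after w c + y⁺ w c                                     ≡⟨ cong₂ _+_ (sendAll-received v O (allFin (outs net v)) read (toNode w c)) (addAt-hits y v a 1 w c) ⟩
      D + emitted v a q (toNode w c) + (y w c + h * 1)            ≡⟨ cong (λ r → D + emitted v a r (toNode w c) + (y w c + h * 1)) (node-state I v) ⟩
      D + E (toNode w c) + (y w c + h * 1)                        ≡⟨ regroup D (E (toNode w c)) (y w c) h ⟩
      D + h + y w c + E (toNode w c)                              ≡⟨ cong (λ x → x + y w c + E (toNode w c)) (decAt-hits (pend cfg) v a cfg-va≡ w c) ⟩
      pend cfg w c + y w c + E (toNode w c)                       ≡⟨ cong (_+ E (toNode w c)) (pending I w c) ⟩
      inflow (toNode w c) e y + E (toNode w c)                    ≡⟨ inflow-node (toNode w c) e ⟨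
      inflow (toNode w c) e y⁺                                    ∎
      where
      D : ℕ
      D = decAt {net = net} (pend cfg) v a w c
      h : ℕ
      h = hits (toNode v a) (toNode w c)
      regroup : ∀ d e y h → d + e + (y + h * 1) ≡ d + h + y + e
      regroup = solve-∀

  invariant-reachable : ∀ {X cfg cfg′ e y} → Invariant X cfg e y → Star (Step {net = net}) cfg cfg′ →
                        Σ (Fin m → ℕ) λ e′ → Σ Counts λ y′ → Invariant X cfg′ e′ y′
  invariant-reachable I ε                              = _ , _ , I
  invariant-reachable I (extStep _ i cfg-i≡ ◅ steps)   = invariant-reachable (invariant-input i cfg-i≡ I) steps
  invariant-reachable I (nodeStep _ v a cfg-va≡ ◅ steps) = invariant-reachable (invariant-node v a cfg-va≡ I) steps

  IsFixed : (Fin m → ℕ) → Counts → Set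
  IsFixed X y = ∀ v c → y v c ≡ inflow (toNode v c) X y

  halted-fixed : ∀ X {cfg} → Star (Step {net = net}) (initial s X) cfg → Halted cfg →
                 Σ Counts λ y → IsFixed X y × (∀ j → outCount cfg j ≡ inflow (toOut j) X y)
  halted-fixed X run (no-input , no-pending) with invariant-reachable (invariant-initial X) run
  ... | e , y , I = y , fixed , λ j → trans (output I j) (inflow-X (toOut j))
    where
    e≡X : ∀ i → e i ≡ X i
    e≡X i = trans (cong (_+ e i) (sym (no-input i))) (ext-pending I i)
    inflow-X : ∀ d → inflow d e y ≡ inflow d X y
    inflow-X d = cong (_+ sumL (allFin (N net)) (fromNode d y))
                      (sumL-cong (allFin m) (λ i → cong (_* hits (inWire net i) d) (e≡X i)))
    fixed : IsFixed X y
    fixed v c = trans (cong (_+ y v c) (sym (no-pending v c))) (trans (pending I v c) (inflow-X (toNode v c)))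

module FixedPointBounds {m p} (net : Network m p) (s : (v : Fin (N net)) → Fin (nQ (proc net v))) where
  open Execution net s

  -- A quantity Q x y depends on the number x of letters fed to every network input wire
  -- and on the counts y read by the nodes.
  Quantity : Set
  Quantity = ℕ → Counts → ℕ

  record Sandwiched (T α C : ℕ) (Q : Quantity) : Set where
    constructor sandwiched
    field squeeze : ∀ n y → IsFixed (λ _ → T * n) y → α * n ≤ Q (T * n) y × Q (T * n) y ≤ α * n + C
  open Sandwiched

  record Affine (Q : Quantity) : Set where
    constructor affine
    field
      scale   : ℕ
      scale≥1 : 1 ≤ scale
      slope   : ℕ
      error   : ℕ
      bounds  : Sandwiched scale slope error Q

  -- Bounds on the scale T give bounds on any multiple T j (substitute j n for n).
  sandwiched-rescale : ∀ {T α C Q} j → Sandwiched T α C Q → Sandwiched (T * j) (α * j) C Q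
  sandwiched-rescale {T} {α} {C} {Q} j B = sandwiched rescaled
    where
    rescaled : ∀ n y → IsFixed (λ _ → T * j * n) y → α * j * n ≤ Q (T * j * n) y × Q (T * j * n) y ≤ α * j * n + C
    rescaled n y fixed rewrite *-assoc T j n | *-assoc α j n = squeeze B (j * n) y fixed

  sandwiched-+ : ∀ {T α₁ C₁ α₂ C₂ Q₁ Q₂} → Sandwiched T α₁ C₁ Q₁ → Sandwiched T α₂ C₂ Q₂ →
                 Sandwiched T (α₁ + α₂) (C₁ + C₂) (λ x y → Q₁ x y + Q₂ x y)
  sandwiched-+ {T} {α₁} {C₁} {α₂} {C₂} {Q₁} {Q₂} B₁ B₂ = sandwiched both
    where
    regroup : ∀ a b n c d → a * n + c + (b * n + d) ≡ (a + b) * n + (c + d)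
    regroup = solve-∀
    both : ∀ n y → IsFixed (λ _ → T * n) y →
           (α₁ + α₂) * n ≤ Q₁ (T * n) y + Q₂ (T * n) y × Q₁ (T * n) y + Q₂ (T * n) y ≤ (α₁ + α₂) * n + (C₁ + C₂)
    both n y fixed
      with lower₁ , upper₁ ← squeeze B₁ n y fixed | lower₂ , upper₂ ← squeeze B₂ n y fixed =
      subst (_≤ Q₁ (T * n) y + Q₂ (T * n) y) (sym (*-distribʳ-+ n α₁ α₂)) (+-mono-≤ lower₁ lower₂) ,
      subst (Q₁ (T * n) y + Q₂ (T * n) y ≤_) (regroup α₁ α₂ n C₁ C₂) (+-mono-≤ upper₁ upper₂)

  -- Two affine quantities are bounded on the common scale T₁ T₂, so their sum is affine.
  affine-+ : ∀ {Q₁ Q₂} → Affine Q₁ → Affine Q₂ → Affine (λ x y → Q₁ x y + Q₂ x y)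
  affine-+ {Q₁} {Q₂} (affine T₁ T₁≥1 α₁ C₁ B₁) (affine T₂ T₂≥1 α₂ C₂ B₂) =
    affine (T₁ * T₂) (*-mono-≤ T₁≥1 T₂≥1) (α₁ * T₂ + α₂ * T₁) (C₁ + C₂)
      (sandwiched-+ {Q₁ = Q₁} {Q₂ = Q₂} (sandwiched-rescale T₂ B₁)
        (subst (λ T → Sandwiched T (α₂ * T₁) C₂ Q₂) (*-comm T₂ T₁) (sandwiched-rescale T₁ B₂)))

  affine-cong : ∀ {Q Q′} → (∀ x y → IsFixed (λ _ → x) y → Q x y ≡ Q′ x y) → Affine Q → Affine Q′
  affine-cong Q≡Q′ (affine T T≥1 α C B) = affine T T≥1 α C (sandwiched λ n y fixed →
    subst (λ z → α * n ≤ z × z ≤ α * n + C) (Q≡Q′ (T * n) y fixed) (squeeze B n y fixed))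

  affine-zero : Affine (λ _ _ → 0)
  affine-zero = affine 1 ≤-refl 0 0 (sandwiched λ n y fixed → z≤n , z≤n)

  affine-input : ∀ h → Affine (λ x _ → x * h)
  affine-input h = affine 1 ≤-refl h 0 (sandwiched λ n y fixed →
    ≤-reflexive (trans (*-comm h n) (cong (_* h) (sym (+-identityʳ n)))) ,
    ≤-reflexive (trans (cong (_* h) (+-identityʳ n)) (trans (*-comm n h) (sym (+-identityʳ (h * n))))))

  affine-sumL : ∀ {A : Set} (L : List A) (Q : A → Quantity) → (∀ i → Affine (Q i)) → Affine (λ x y → sumL L (λ i → Q i x y))
  affine-sumL []      Q affine-Q = affine-zero
  affine-sumL (i ∷ L) Q affine-Q = affine-+ {Q i} (affine-Q i) (affine-sumL L Q affine-Q)

  record NodeAffine (v : Node) : Set where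
    constructor nodeAffine
    field
      scale   : ℕ
      scale≥1 : 1 ≤ scale
      slope   : Fin (ins net v) → ℕ
      error   : Fin (ins net v) → ℕ
      bounds  : ∀ c → Sandwiched scale (slope c) (error c) (λ _ y → y v c)

  node-affine : ∀ v → (∀ c → Affine (λ _ y → y v c)) → NodeAffine v
  node-affine v wire-affine = nodeAffine T T≥1 (λ c → Affine.slope (wire-affine c) * j c) (λ c → Affine.error (wire-affine c)) bounds
    where
    common : Σ ℕ λ T → 1 ≤ T × (∀ c → Affine.scale (wire-affine c) ∣ T)
    common = commonMultiple (ins net v) (λ c → Affine.scale (wire-affine c)) (λ c → Affine.scale≥1 (wire-affine c))
    T : ℕ
    T = proj₁ common
    T≥1 : 1 ≤ T
    T≥1 = proj₁ (proj₂ common)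
    j : Fin (ins net v) → ℕ
    j c = _∣_.quotient (proj₂ (proj₂ common) c)
    bounds : ∀ c → Sandwiched T (Affine.slope (wire-affine c) * j c) (Affine.error (wire-affine c)) (λ _ y → y v c)
    bounds c = subst (λ T′ → Sandwiched T′ (Affine.slope (wire-affine c) * j c) (Affine.error (wire-affine c)) (λ _ y → y v c))
                     (trans (*-comm (Affine.scale (wire-affine c)) (j c)) (sym (_∣_.equality (proj₂ (proj₂ common) c))))
                     (sandwiched-rescale (j c) (Affine.bounds (wire-affine c)))

  -- A node whose inputs are affine produces affine outputs: its component is linear up to
  -- bounded error on multiples of its period, and output is monotone in the input.
  output-affine : ∀ v → NodeAffine v → ∀ b → Affine (λ _ y → nodeOut v (y v) b)
  output-affine v (nodeAffine T T≥1 α C B) b =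
    affine (T * P) (*-mono-≤ T≥1 P≥1) (sumL Lv (λ c → α c * r c)) (sumL Lv (λ c → C c * r c) + D) (sandwiched out-bounds)
    where
    open EventuallyLinear (component-linear (comp net v) (s v)) renaming (period to P; period≥1 to P≥1)
    open Abelian (proc net v)
    Lv : List (Fin (ins net v))
    Lv = allFin (ins net v)
    r : Fin (ins net v) → ℕ
    r c = rate c b
    D : ℕ
    D = slack b
    input-bounds : ∀ n y → IsFixed (λ _ → T * P * n) y → ∀ c → α c * (P * n) ≤ y v c × y v c ≤ α c * (P * n) + C c
    input-bounds n y fixed c rewrite *-assoc T P n = Sandwiched.squeeze (B c) (P * n) y fixed
    linear-part : ∀ n → sumL Lv (λ c → α c * n * r c) ≡ sumL Lv (λ c → α c * r c) * n
    linear-part n = trans (sumL-cong Lv (λ c → swap (α c) n (r c))) (sumL-*ʳ Lv (λ c → α c * r c) n)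
      where
      swap : ∀ a n r → a * n * r ≡ a * r * n
      swap = solve-∀
    out-bounds : ∀ n y → IsFixed (λ _ → T * P * n) y →
                 sumL Lv (λ c → α c * r c) * n ≤ nodeOut v (y v) b ×
                 nodeOut v (y v) b ≤ sumL Lv (λ c → α c * r c) * n + (sumL Lv (λ c → C c * r c) + D)
    out-bounds n y fixed = lower-bound , upper-bound
      where
      open ≤-Reasoning
      below : ∀ c → α c * n * P ≤ y v c
      below c = ≤-trans (≤-reflexive (reorder (α c) n P)) (proj₁ (input-bounds n y fixed c))
        where
        reorder : ∀ a n p → a * n * p ≡ a * (p * n)
        reorder = solve-∀
      above : ∀ c → y v c ≤ (α c * n + C c) * P
      above c = begin
        y v c                           ≤⟨ proj₂ (input-bounds n y fixed c) ⟩
        α c * (P * n) + C c             ≤⟨ +-monoʳ-≤ (α c * (P * n)) (≤-trans (≤-reflexive (sym (*-identityʳ (C c)))) (*-monoʳ-≤ (C c) P≥1)) ⟩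
        α c * (P * n) + C c * P         ≡⟨ reorder (α c) n (C c) P ⟩
        (α c * n + C c) * P             ∎
        where
        reorder : ∀ a n c p → a * (p * n) + c * p ≡ (a * n + c) * p
        reorder = solve-∀
      lower-bound : sumL Lv (λ c → α c * r c) * n ≤ nodeOut v (y v) b
      lower-bound = begin
        sumL Lv (λ c → α c * r c) * n                   ≡⟨ linear-part n ⟨
        sumL Lv (λ c → α c * n * r c)                   ≤⟨ lower (λ c → α c * n) b ⟩
        runOut (proc net v) (wordOf (λ c → α c * n * P)) (s v) b ≤⟨ wordOf-mono _ (y v) below (s v) b ⟩
        nodeOut v (y v) b                               ∎
      upper-bound : nodeOut v (y v) b ≤ sumL Lv (λ c → α c * r c) * n + (sumL Lv (λ c → C c * r c) + D)
      upper-bound = begin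
        nodeOut v (y v) b                                                ≤⟨ wordOf-mono (y v) _ above (s v) b ⟩
        runOut (proc net v) (wordOf (λ c → (α c * n + C c) * P)) (s v) b ≤⟨ upper (λ c → α c * n + C c) b ⟩
        sumL Lv (λ c → (α c * n + C c) * r c) + D                        ≡⟨ cong (_+ D) (sumL-cong Lv (λ c → *-distribʳ-+ (r c) (α c * n) (C c))) ⟩
        sumL Lv (λ c → α c * n * r c + C c * r c) + D                    ≡⟨ cong (_+ D) (sumL-+ Lv _ _) ⟩
        sumL Lv (λ c → α c * n * r c) + sumL Lv (λ c → C c * r c) + D    ≡⟨ cong (λ z → z + sumL Lv (λ c → C c * r c) + D) (linear-part n) ⟩
        sumL Lv (λ c → α c * r c) * n + sumL Lv (λ c → C c * r c) + D    ≡⟨ +-assoc (sumL Lv (λ c → α c * r c) * n) _ D ⟩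
        sumL Lv (λ c → α c * r c) * n + (sumL Lv (λ c → C c * r c) + D) ∎

  hits-cases : ∀ d d′ → hits d d′ ≡ 0 ⊎ (hits d d′ ≡ 1 × d ≡ d′)
  hits-cases (toOut j)    (toOut j′) with j ≟ j′
  ... | yes refl = inj₂ (refl , refl)
  ... | no _     = inj₁ refl
  hits-cases (toOut _)    (toNode _ _) = inj₁ refl
  hits-cases (toNode _ _) (toOut _)    = inj₁ refl
  hits-cases (toNode w c) (toNode v a) with w ≟ v
  ... | no _     = inj₁ refl
  ... | yes refl with c ≟ a
  ...   | yes refl = inj₂ (refl , refl)
  ...   | no _     = inj₁ refl

  inflow-affine : ∀ d → (∀ u b → wire net u b ≡ d → NodeAffine u) → Affine (λ x y → inflow d (λ _ → x) y)
  inflow-affine d senders-affine =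
    affine-+ (affine-sumL (allFin m) (λ i x _ → x * hits (inWire net i) d) (λ i → affine-input (hits (inWire net i) d)))
             (affine-sumL (allFin (N net)) (λ u _ y → fromNode d y u) λ u →
                affine-sumL (allFin (outs net u)) (λ b _ y → hits (wire net u b) d * nodeOut u (y u) b) (wire-affine u))
    where
    wire-affine : ∀ u b → Affine (λ _ y → hits (wire net u b) d * nodeOut u (y u) b)
    wire-affine u b with hits-cases (wire net u b) d
    ... | inj₁ no-hit = affine-cong (λ x y _ → sym (cong (_* nodeOut u (y u) b) no-hit)) affine-zero
    ... | inj₂ (hit , wired) = affine-cong (λ x y _ → sym (trans (cong (_* nodeOut u (y u) b) hit) (+-identityʳ _)))
                                           (output-affine u (senders-affine u b wired) b)

  -- A node whose predecessors are affine is affine: its inputs solve the inflow equations.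
  affine-from-predecessors : ∀ v → (∀ u → Edge net u v → NodeAffine u) → NodeAffine v
  affine-from-predecessors v predecessors-affine = node-affine v λ c →
    affine-cong (λ x y fixed → sym (fixed v c)) (inflow-affine (toNode v c) (λ u b wired → predecessors-affine u (edge b c wired)))

  -- A walk of n edges ending at v, recorded backwards from v.
  data Walk : ℕ → Node → Set where
    stay : ∀ v → Walk 0 v
    step : ∀ {n u v} → Edge net u v → Walk n u → Walk (suc n) v

  -- the i-th node of a walk, counted backwards from its end
  vertex : ∀ {n v} → Walk n v → Fin (suc n) → Node
  vertex {v = v} w        zero    = v
  vertex         (step e w) (suc i) = vertex w i

  path-between : ∀ {n v} (w : Walk n v) (i j : Fin (suc n)) → toℕ i < toℕ j →
                 TransClosure (Edge net) (vertex w j) (vertex w i)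
  path-between (step e w) zero    (suc zero)    _         = [ e ]
  path-between (step e w) zero    (suc (suc j)) _         = path-between w zero (suc j) (s≤s z≤n) ∷ʳ e
  path-between (step e w) (suc i) (suc j)       (s≤s i<j) = path-between w i j i<j

  -- A walk with as many edges as there are nodes repeats a node, hence closes a cycle.
  no-long-walk : Acyclic net → ∀ v → ¬ Walk (N net) v
  no-long-walk acyclic v w with i , j , i<j , same ← pigeonhole (n<1+n (N net)) (vertex w) =
    acyclic (vertex w j) (subst (TransClosure (Edge net) (vertex w j)) same (path-between w i j i<j))

  -- Induction on the length of the longest walk into v.
  affine-below : ∀ n v → ¬ Walk n v → NodeAffine v
  affine-below zero    v no-walk = ⊥-elim (no-walk (stay v))
  affine-below (suc n) v no-walk = affine-from-predecessors v λ u e → affine-below n u (λ w → no-walk (step e w))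

  all-affine : Acyclic net → ∀ v → NodeAffine v
  all-affine acyclic v = affine-below (N net) v (no-long-walk acyclic v)

delayer-output : ∀ (X : Fin 1 → ℕ) → compute delayer zero X zero ≡ X zero ∸ 1
delayer-output X = trans (cong (λ W → runOut delayer W zero zero) (++-identityʳ (replicate (X zero) zero))) (from-start (X zero))
  where
  passing : ∀ n → runOut delayer (replicate n zero) (suc zero) zero ≡ n
  passing zero    = refl
  passing (suc n) = cong suc (passing n)
  from-start : ∀ n → runOut delayer (replicate n zero) zero zero ≡ n ∸ 1
  from-start zero    = refl
  from-start (suc n) = passing n

-- x ↦ x ∸ 1 is not affine: bounds α n ≤ T n ∸ 1 ≤ α n + C force α < T from n = 1,
-- and then T n ∸ 1 ≥ α n + n ∸ 1 exceeds α n + C at n = C + 2.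
predecessor-not-affine : ∀ T α C → 1 ≤ T → ¬ (∀ n → α * n ≤ T * n ∸ 1 × T * n ∸ 1 ≤ α * n + C)
predecessor-not-affine T α C T≥1 bounds = 1+n≰n (≤-trans too-large (proj₂ (bounds n)))
  where
  n : ℕ
  n = C + 2
  α<T : α + 1 ≤ T
  α<T = ≤-trans (+-monoˡ-≤ 1 (subst₂ (λ a b → a ≤ b ∸ 1) (*-identityʳ α) (*-identityʳ T) (proj₁ (bounds 1))))
                (≤-reflexive (m∸n+n≡m T≥1))
  expand : ∀ α C → (α + 1) * (C + 2) ≡ 2 + (α * (C + 2) + C)
  expand = solve-∀
  too-large : suc (α * n + C) ≤ T * n ∸ 1
  too-large = ∸-monoˡ-≤ 1 (subst (_≤ T * n) (expand α C) (*-monoˡ-≤ n α<T))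

proposition7p7 : (net : Network 1 1) → Acyclic net → ¬ Emulates net delayer zero
proposition7p7 net acyclic (s , computes) = predecessor-not-affine scale slope error scale≥1 delayer-bounds
  where
  open Execution net s
  open FixedPointBounds net s
  -- the network output is affine, since every node of an acyclic network is
  open Affine (inflow-affine (toOut zero) (λ u _ _ → all-affine acyclic u))
  -- on input T n a halted run reads a fixed point y, and its output is T n ∸ 1
  delayer-bounds : ∀ n → slope * n ≤ scale * n ∸ 1 × scale * n ∸ 1 ≤ slope * n + error
  delayer-bounds n
    with (cfg , run , halted) , correct ← computes (λ _ → scale * n)
    with y , fixed , output ← halted-fixed (λ _ → scale * n) run halted
    = subst (λ z → slope * n ≤ z × z ≤ slope * n + error)
            (trans (sym (output zero)) (trans (correct cfg run halted zero) (delayer-output (λ _ → scale * n))))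
            (Sandwiched.squeeze bounds n y fixed)
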